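{- Let $g\geq3$, let $m\geq1$ and $n\geq3$ be odd integers, and let $\Gamma=(\mathbb Z_m\times\mathbb Z_{4n})\rtimes\mathbb Z_2$. Then an $RSM_\Gamma(\Gamma,g;[^{8mn-1}m,\ ^{1}2n])$ exists.
   Context: The generalized dihedral group $(\mathbb Z_m\times\mathbb Z_{4n})\rtimes\mathbb Z_2$ has underlying set $(\mathbb Z_m\times\mathbb Z_{4n})\times\mathbb Z_2$ and operation $(u,\tau)+(u',\tau')=(u+(-1)^\tau u',\tau+\tau')$. A list is a multiset; $[^{a}x,\ ^{b}y]$ has $a$ copies of $x$ and $b$ copies of $y$. For $S\subseteq\Gamma$, an $|S|$-list $\Sigma$ and $g\ge2$, a row-sum matrix $RSM_\Gamma(S,g;\Sigma)$ is an $|S|\times g$ matrix with entries in $\Gamma$ each of whose columns is a permutation of $S$, such that the multiset of left-to-right row sums is $\Sigma$. $RSM_\Gamma(S,g;L)$ with $L$ a list of positive integers means an $RSM_\Gamma(S,g;\Sigma)$ for some $\Sigma$ whose list of element orders equals $L$. -}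

module Defs where

open import Data.Nat using (ℕ; zero; suc; _+_; _*_; _∸_; _<_)
open import Data.Nat.DivMod using (_mod_)
open import Data.Fin using (Fin; toℕ)
open import Data.Product using (_×_; _,_; Σ; ∃)
open import Data.List using (List; map; replicate; _++_; [_])
open import Data.Fin.Base using () renaming (zero to fz)
open import Relation.Binary.PropositionalEquality using (_≡_; _≢_)
open import Data.Empty using (⊥)
open import Data.List.Relation.Binary.Permutation.Propositional using (_↭_)
open import Data.List using (allFin)

addF : ∀ {k} → Fin k → Fin k → Fin k
addF {suc k} a b = (toℕ a + toℕ b) mod (suc k)

negF : ∀ {k} → Fin k → Fin k
negF {suc k} a = (suc k ∸ toℕ a) mod (suc k)

zeroF : ∀ {k} → Fin (suc k)
zeroF = fz

-- Underlying set of Γ = (ℤ_m × ℤ_{4n}) ⋊ ℤ_2 : ((a , b) , τ)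
-- (wrapped in a record so that m and n are inferable)
record GD (m n : ℕ) : Set where
  constructor ⟨_⟩
  field elt : (Fin m × Fin (4 * n)) × Fin 2

_⊕_ : ∀ {m n} → GD m n → GD m n → GD m n
⟨ (a , b) , τ ⟩ ⊕ ⟨ (a' , b') , τ' ⟩ with toℕ τ
... | zero  = ⟨ (addF a a' , addF b b') , addF τ τ' ⟩
... | suc _ = ⟨ (addF a (negF a') , addF b (negF b')) , addF τ τ' ⟩

-- identity element (needs m ≥ 1; 4n ≥ 1 is supplied by the index form)
identity : ∀ {m n} → GD (suc m) (suc n)
identity = ⟨ (zeroF , zeroF) , zeroF ⟩

mult : ∀ {m n} → ℕ → GD (suc m) (suc n) → GD (suc m) (suc n)
mult zero    x = identity
mult (suc k) x = mult k x ⊕ x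

HasOrder : ∀ {m n} → GD (suc m) (suc n) → ℕ → Set
HasOrder x d = (0 < d) × (mult d x ≡ identity) × (∀ k → 0 < k → k < d → mult k x ≢ identity)

Bijective : {A B : Set} → (A → B) → Set
Bijective {A} {B} f = (∀ x y → f x ≡ f y → x ≡ y) × (∀ b → Σ A λ a → f a ≡ b)

rowSumFrom : ∀ {m n} h → GD m n → (Fin h → GD m n) → GD m n
rowSumFrom zero    acc r = acc
rowSumFrom (suc h) acc r = rowSumFrom h (acc ⊕ r fz) (λ j → r (Fin.suc j))

rowSum : ∀ {m n} g → (Fin g → GD (suc m) (suc n)) → GD (suc m) (suc n)
rowSum zero    r = identity
rowSum (suc g) r = rowSumFrom g (r fz) (λ j → r (Fin.suc j))

-- RSM_Γ(Γ, g; L) with S = Γ: an |Γ| × g matrix (|Γ| = 8mn) whose columns are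
-- permutations of Γ (bijections from row indices onto Γ), and whose row sums
-- have list of element orders equal (as a multiset) to L.
-- (Γ is only a group for m ≥ 1, n ≥ 1; otherwise the type is empty.)
RSM-Γ-orders : (m n g : ℕ) → List ℕ → Set
RSM-Γ-orders zero    n       g L = ⊥
RSM-Γ-orders (suc m) zero    g L = ⊥
RSM-Γ-orders (suc m) (suc n) g L =
  Σ (Fin N → Fin g → GD (suc m) (suc n)) λ M →
    (∀ j → Bijective (λ i → M i j)) ×
    Σ (Fin N → ℕ) λ ords →
      (∀ i → HasOrder (rowSum g (M i)) (ords i)) ×
      (map ords (allFin N) ↭ L)
  where
  N = 8 * suc m * suc n

{-# OPTIONS --safe #-}

-- The rows of the matrix are indexed by Γ itself. The key ingredient is a complete mapping θ of Γ:
-- both θ and θ⁺ x = x ⊕ θ x are bijections. On the ℤₘ-coordinate θ⁺ doubles, which is invertible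
-- as m is odd; on the ℤ₄ₙ-coordinate it doubles (or doubles and subtracts 1), and the bit τ b,
-- which depends on b mod 4, recovers what doubling loses because 2n ≡ 2 (mod 4).
-- Row x reads x, θ (σ⁻¹ x), θ q, θ (θ⁺ q), …, θ (θ⁺ᵏ⁻¹ q), (⊖ θ⁺ᵏ q) ⊕ e with q = θ⁺ (σ x), so as long
-- as x ⊕ θ (σ⁻¹ x) = θ⁺ (σ x) its sum telescopes to e = (8, 0), of order m. For σ the identity this
-- holds for every x; instead σ is a 3-cycle of three special elements p₀, p₁, p₂, chosen so that the
-- equation survives at p₁ and p₂ and fails at p₀ by an offset d, whose row then sums to d ⊕ e = (0, 2),
-- of order 2n. Each column is an injective, hence bijective, function of the row index.

module Submission where

open import Data.Nat.Base as ℕ using (ℕ; zero; suc)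
import Data.Nat.Properties as ℕ
open import Data.Nat.DivMod using (_mod_; _%_; _/_; m≡m%n+[m/n]*n)
open import Data.Nat.Divisibility using (_∣_; divides; ∣-refl; ∣m∣n⇒∣m+n)
import Data.Nat.Tactic.RingSolver as ℕ-Ring
open import Data.Integer.Base as ℤ using (ℤ; +_; +[1+_]; -[1+_]; +0)
import Data.Integer.Properties as ℤ
import Data.Integer.DivMod as ℤ
open import Data.Integer.Tactic.RingSolver using (solve-∀)
open import Data.Fin.Base using (Fin; toℕ; punchOut; cast)
import Data.Fin.Properties as Fin
open import Data.Fin.Patterns using (0F; 1F; 2F; 3F)
open import Data.Vec.Base using (Vec; lookup; []; _∷_)
open import Data.List.Base using (List; tabulate; replicate; _++_; [_]; map; allFin; _∷_)
import Data.List.Properties as List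
open import Data.List.Relation.Binary.Permutation.Propositional using (_↭_; ↭-trans; ↭-reflexive; prep)
open import Data.List.Relation.Binary.Permutation.Propositional.Properties using (∷↭∷ʳ)
open import Data.Product.Base using (_,_; ∃)
import Data.Product.Properties as Product
open import Data.Product.Function.NonDependent.Propositional using (_×-↔_)
open import Data.Sum.Base using (_⊎_; inj₁; inj₂; [_,_]′)
open import Data.Empty using (⊥; ⊥-elim)
open import Function.Base using (_∘_)
open import Function.Bundles using (_↔_; Inverse; mk↔ₛ′)
open import Function.Definitions using (Injective)
open import Function.Construct.Composition using (_↔-∘_)
open import Function.Construct.Identity using (↔-id)
open import Level using (0ℓ)
open import Relation.Nullary using (Dec; yes; no; ¬_)
open import Relation.Nullary.Decidable using (map′)
open import Relation.Nullary.Negation using (contradiction)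
open import Relation.Binary.Bundles using (Setoid)
open import Relation.Binary.Structures using (IsEquivalence)
open import Relation.Binary.Definitions using (DecidableEquality)
open import Relation.Binary.PropositionalEquality hiding ([_])
import Relation.Binary.Reasoning.Setoid as SetoidReasoning
open import Algebra.Bundles using (Group)
open import Algebra.Structures using (IsGroup)
open import Defs

module Congruence where

  open import Data.Integer.Base using (_+_; _*_; -_; _-_)

  infix 4 _≡_modulo_
  record _≡_modulo_ (x y : ℤ) (k : ℕ) : Set where
    constructor mk≡mod
    field
      quotient : ℤ
      equation : x ≡ y + quotient * + k

  module _ {k : ℕ} where

    ≡⇒≡-mod : ∀ {x y} → x ≡ y → x ≡ y modulo k
    ≡⇒≡-mod {x} refl = mk≡mod +0 (ring x (+ k))
      where ring : ∀ x K → x ≡ x + +0 * K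
            ring = solve-∀

    ≡-mod-refl : ∀ {x} → x ≡ x modulo k
    ≡-mod-refl = ≡⇒≡-mod refl

    ≡-mod-sym : ∀ {x y} → x ≡ y modulo k → y ≡ x modulo k
    ≡-mod-sym {x} {y} (mk≡mod q e) = mk≡mod (- q) (begin
      y                     ≡⟨ ring y q (+ k) ⟩
      y + q * + k + - q * + k ≡⟨ cong (_+ - q * + k) e ⟨
      x + - q * + k         ∎)
      where open ≡-Reasoning
            ring : ∀ y q K → y ≡ y + q * K + - q * K
            ring = solve-∀

    ≡-mod-trans : ∀ {x y z} → x ≡ y modulo k → y ≡ z modulo k → x ≡ z modulo k
    ≡-mod-trans {x} {y} {z} (mk≡mod q e) (mk≡mod r f) = mk≡mod (r + q) (begin
      x                     ≡⟨ e ⟩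
      y + q * + k           ≡⟨ cong (_+ q * + k) f ⟩
      z + r * + k + q * + k ≡⟨ ring z r q (+ k) ⟩
      z + (r + q) * + k     ∎)
      where open ≡-Reasoning
            ring : ∀ z r q K → z + r * K + q * K ≡ z + (r + q) * K
            ring = solve-∀

    +-cong-mod : ∀ {x x′ y y′} → x ≡ x′ modulo k → y ≡ y′ modulo k → x + y ≡ x′ + y′ modulo k
    +-cong-mod {x′ = x′} {y′ = y′} (mk≡mod q e) (mk≡mod r f) =
      mk≡mod (q + r) (trans (cong₂ _+_ e f) (ring x′ y′ q r (+ k)))
      where ring : ∀ x y q r K → x + q * K + (y + r * K) ≡ x + y + (q + r) * K
            ring = solve-∀

    neg-cong-mod : ∀ {x y} → x ≡ y modulo k → - x ≡ - y modulo k
    neg-cong-mod {y = y} (mk≡mod q e) = mk≡mod (- q) (trans (cong -_ e) (ring y q (+ k)))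
      where ring : ∀ y q K → - (y + q * K) ≡ - y + - q * K
            ring = solve-∀

    *-congˡ-mod : ∀ c {x y} → x ≡ y modulo k → c * x ≡ c * y modulo k
    *-congˡ-mod c {y = y} (mk≡mod q e) = mk≡mod (c * q) (trans (cong (c *_) e) (ring c y q (+ k)))
      where ring : ∀ c y q K → c * (y + q * K) ≡ c * y + c * q * K
            ring = solve-∀

    +-multiple-mod : ∀ x q → x + q * + k ≡ x modulo k
    +-multiple-mod x q = mk≡mod q refl

    ≡-mod-subst : ∀ {x y x′ y′} → x ≡ y → x ≡ x′ modulo k → y ≡ y′ modulo k → x′ ≡ y′ modulo k
    ≡-mod-subst refl x≡x′ x≡y′ = ≡-mod-trans (≡-mod-sym x≡x′) x≡y′

  ≡-mod-isEquivalence : ∀ k → IsEquivalence (λ x y → x ≡ y modulo k)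
  ≡-mod-isEquivalence k = record { refl = ≡-mod-refl ; sym = ≡-mod-sym ; trans = ≡-mod-trans }

  ℤ-mod-setoid : ℕ → Setoid 0ℓ 0ℓ
  ℤ-mod-setoid k = record { isEquivalence = ≡-mod-isEquivalence k }

  ≡-mod-divisor : ∀ {k d x y} c → + k ≡ + d * c → x ≡ y modulo k → x ≡ y modulo d
  ≡-mod-divisor {k} {d} {y = y} c k≡dc (mk≡mod q e) =
    mk≡mod (q * c) (trans e (trans (cong (λ K → y + q * K) k≡dc) (ring y q (+ d) c)))
    where ring : ∀ y q D c → y + q * (D * c) ≡ y + q * c * D
          ring = solve-∀

  ≥-modulus : ∀ {a b j k} → + a ≡ + b + +[1+ j ] * + k → k ℕ.≤ a
  ≥-modulus {a} {b} {j} {k} e =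
    subst (k ℕ.≤_) (sym a≡b+[1+j]k) (ℕ.≤-trans (ℕ.m≤m+n k (j ℕ.* k)) (ℕ.m≤n+m _ b))
    where
    a≡b+[1+j]k : a ≡ b ℕ.+ suc j ℕ.* k
    a≡b+[1+j]k = ℤ.+-injective (begin
      + a                   ≡⟨ e ⟩
      + b + + suc j * + k   ≡⟨ cong (_+_ (+ b)) (ℤ.pos-* (suc j) k) ⟨
      + b + + (suc j ℕ.* k) ≡⟨ ℤ.pos-+ b _ ⟨
      + (b ℕ.+ suc j ℕ.* k) ∎)
      where open ≡-Reasoning

  ≡-mod-ℕ-injective : ∀ {k a b} → a ℕ.< k → b ℕ.< k → + a ≡ + b modulo k → a ≡ b
  ≡-mod-ℕ-injective {k} {b = b} _ _ (mk≡mod +0 e) = ℤ.+-injective (trans e (ring (+ b) (+ k)))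
    where ring : ∀ b K → b + +0 * K ≡ b
          ring = solve-∀
  ≡-mod-ℕ-injective {k} {a} {b} a<k _ (mk≡mod +[1+ j ] e) =
    ⊥-elim (ℕ.<⇒≱ a<k (≥-modulus {a} {b} {j} {k} e))
  ≡-mod-ℕ-injective {k} {a} {b} _ b<k (mk≡mod -[1+ j ] e) =
    ⊥-elim (ℕ.<⇒≱ b<k (≥-modulus {b} {a} {j} {k} (_≡_modulo_.equation (≡-mod-sym {k} (mk≡mod -[1+ j ] e)))))

  module ≡-mod-Reasoning (k : ℕ) = SetoidReasoning (ℤ-mod-setoid k)

  halve-mod-odd : ∀ s {x y} → x + x ≡ y + y modulo suc (s ℕ.+ s) → x ≡ y modulo suc (s ℕ.+ s)
  halve-mod-odd s {x} {y} 2x≡2y = begin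
    x                  ≈⟨ ≡-mod-sym (halve x) ⟩
    + suc s * (x + x)  ≈⟨ *-congˡ-mod (+ suc s) 2x≡2y ⟩
    + suc s * (y + y)  ≈⟨ halve y ⟩
    y                  ∎
    where
    open ≡-mod-Reasoning (suc (s ℕ.+ s))
    ring : ∀ z s → (+ 1 + s) * (z + z) ≡ z + z * (+ 1 + (s + s))
    ring = solve-∀
    halve : ∀ z → + suc s * (z + z) ≡ z modulo suc (s ℕ.+ s)
    halve z = mk≡mod z (trans (cong (_* (z + z)) (ℤ.pos-+ 1 s)) (trans (ring z (+ s))
      (cong (λ K → z + z * K) (sym (trans (ℤ.pos-+ 1 (s ℕ.+ s)) (cong (_+_ (+ 1)) (ℤ.pos-+ s s)))))))

  +-cancelʳ-mod : ∀ {k x y} c → x + c ≡ y + c modulo k → x ≡ y modulo k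
  +-cancelʳ-mod {k} {x} {y} c x+c≡y+c = begin
    x            ≡⟨ ring x c ⟩
    x + c + - c  ≈⟨ +-cong-mod x+c≡y+c ≡-mod-refl ⟩
    y + c + - c  ≡⟨ ring y c ⟨
    y            ∎
    where open ≡-mod-Reasoning k
          ring : ∀ x c → x ≡ x + c + - c
          ring = solve-∀

  halve-mod-double : ∀ {k x y} → x + x ≡ y + y modulo (2 ℕ.* k) → x ≡ y modulo k
  halve-mod-double {k} {x} {y} (mk≡mod q e) = mk≡mod q (ℤ.*-cancelˡ-≡ (+ 2) x (y + q * + k) (begin
    + 2 * x                 ≡⟨ ring₁ x ⟩
    x + x                   ≡⟨ e ⟩
    y + y + q * + (2 ℕ.* k) ≡⟨ cong (λ K → y + y + q * K) (ℤ.pos-* 2 k) ⟩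
    y + y + q * (+ 2 * + k) ≡⟨ ring₂ y q (+ k) ⟩
    + 2 * (y + q * + k)     ∎))
    where
    open ≡-Reasoning
    ring₁ : ∀ x → + 2 * x ≡ x + x
    ring₁ = solve-∀
    ring₂ : ∀ y q K → y + y + q * (+ 2 * K) ≡ + 2 * (y + q * K)
    ring₂ = solve-∀

  ≡-mod-parity-split : ∀ {k x y} → x ≡ y modulo k →
                       x ≡ y modulo (2 ℕ.* k) ⊎ x ≡ y + + k modulo (2 ℕ.* k)
  ≡-mod-parity-split {k} {x} {y} (mk≡mod q e) =
    split (q ℤ.%ℕ 2) (q ℤ./ℕ 2) (ℤ.n%ℕd<d q 2) (trans e (cong (λ q → y + q * + k) (ℤ.a≡a%ℕn+[a/ℕn]*n q 2)))
    where
    2k≡2*k : + (2 ℕ.* k) ≡ + 2 * + k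
    2k≡2*k = ℤ.pos-* 2 k
    split : ∀ r w → r ℕ.< 2 → x ≡ y + (+ r + w * + 2) * + k →
            x ≡ y modulo (2 ℕ.* k) ⊎ x ≡ y + + k modulo (2 ℕ.* k)
    split 0 w _ e = inj₁ (mk≡mod w (trans e (trans (ring₀ y w (+ k)) (cong (λ K → y + w * K) (sym 2k≡2*k)))))
      where ring₀ : ∀ y w K → y + (+ 0 + w * + 2) * K ≡ y + w * (+ 2 * K)
            ring₀ = solve-∀
    split 1 w _ e = inj₂ (mk≡mod w (trans e (trans (ring₁ y w (+ k)) (cong (λ K → y + + k + w * K) (sym 2k≡2*k)))))
      where ring₁ : ∀ y w K → y + (+ 1 + w * + 2) * K ≡ y + K + w * (+ 2 * K)
            ring₁ = solve-∀
    split (suc (suc _)) _ (ℕ.s≤s (ℕ.s≤s ())) _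

  ¬double≡double-1-modulo2 : ∀ x y → ¬ (x + x ≡ y + y - + 1 modulo 2)
  ¬double≡double-1-modulo2 x y 2x≡2y-1 =
    contradiction (≡-mod-ℕ-injective (ℕ.s≤s (ℕ.s≤s ℕ.z≤n)) (ℕ.s≤s ℕ.z≤n) 1≡0) λ ()
    where
    open ≡-mod-Reasoning 2
    ring₁ : ∀ y → + 1 ≡ y + y - (y + y - + 1)
    ring₁ = solve-∀
    ring₂ : ∀ x y → y + y - (x + x) ≡ + 0 + (y - x) * + 2
    ring₂ = solve-∀
    1≡0 : + 1 ≡ + 0 modulo 2
    1≡0 = begin
      + 1                      ≡⟨ ring₁ y ⟩
      y + y - (y + y - + 1)    ≈⟨ +-cong-mod (≡-mod-refl {x = y + y}) (neg-cong-mod (≡-mod-sym 2x≡2y-1)) ⟩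
      y + y - (x + x)          ≡⟨ ring₂ x y ⟩
      + 0 + (y - x) * + 2      ≈⟨ +-multiple-mod (+ 0) (y - x) ⟩
      + 0                      ∎

  *8-cancel-mod-odd : ∀ s {x} → x * + 8 ≡ + 0 modulo suc (s ℕ.+ s) → x ≡ + 0 modulo suc (s ℕ.+ s)
  *8-cancel-mod-odd s {x} 8x≡0 =
    halve-mod-odd s (halve-mod-odd s (halve-mod-odd s (≡-mod-trans (≡⇒≡-mod (ring x)) 8x≡0)))
    where ring : ∀ x → x + x + (x + x) + (x + x + (x + x)) ≡ x * + 8
          ring = solve-∀

open Congruence

module FinMod (k : ℕ) where

  open import Data.Integer.Base using (_+_; _*_; -_; _-_)

  ⟦_⟧ : Fin (suc k) → ℤ
  ⟦ a ⟧ = + toℕ a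

  ⟦mod⟧ : ∀ c → ⟦ c mod suc k ⟧ ≡ + c modulo suc k
  ⟦mod⟧ c = ≡-mod-sym (mk≡mod (+ (c / suc k)) (begin
    + c                                         ≡⟨ cong +_ (m≡m%n+[m/n]*n c (suc k)) ⟩
    + (c % suc k ℕ.+ c / suc k ℕ.* suc k)       ≡⟨ ℤ.pos-+ (c % suc k) _ ⟩
    + (c % suc k) + + (c / suc k ℕ.* suc k)     ≡⟨ cong₂ _+_ (cong +_ (sym (Fin.toℕ-fromℕ< _)))
                                                              (ℤ.pos-* (c / suc k) (suc k)) ⟩
    ⟦ c mod suc k ⟧ + + (c / suc k) * + suc k   ∎))
    where open ≡-Reasoning

  ⟦addF⟧ : ∀ a b → ⟦ addF a b ⟧ ≡ ⟦ a ⟧ + ⟦ b ⟧ modulo suc k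
  ⟦addF⟧ a b = ≡-mod-trans (⟦mod⟧ (toℕ a ℕ.+ toℕ b)) (≡⇒≡-mod (ℤ.pos-+ (toℕ a) (toℕ b)))

  ⟦negF⟧ : ∀ a → ⟦ negF a ⟧ ≡ - ⟦ a ⟧ modulo suc k
  ⟦negF⟧ a = ≡-mod-trans (⟦mod⟧ (suc k ℕ.∸ toℕ a)) (mk≡mod (+ 1) (begin
    + (suc k ℕ.∸ toℕ a)      ≡⟨ ℤ.⊖-≥ (ℕ.<⇒≤ (Fin.toℕ<n a)) ⟨
    suc k ℤ.⊖ toℕ a          ≡⟨ ℤ.m-n≡m⊖n (suc k) (toℕ a) ⟨
    + suc k - ⟦ a ⟧          ≡⟨ ring (+ suc k) ⟦ a ⟧ ⟩
    - ⟦ a ⟧ + + 1 * + suc k  ∎))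
    where open ≡-Reasoning
          ring : ∀ K a → K - a ≡ - a + + 1 * K
          ring = solve-∀

  ⟦⟧-injective : ∀ {a b} → ⟦ a ⟧ ≡ ⟦ b ⟧ modulo suc k → a ≡ b
  ⟦⟧-injective {a} {b} = Fin.toℕ-injective ∘ ≡-mod-ℕ-injective (Fin.toℕ<n a) (Fin.toℕ<n b)

  -- Identities between terms over Fin (suc k) are proved by comparing their values in ℤ modulo suc k.
  infixl 6 _⊞_
  data Expr (n : ℕ) : Set where
    var : Fin n → Expr n
    lit : ℕ → Expr n
    _⊞_ : Expr n → Expr n → Expr n
    ⊟_  : Expr n → Expr n

  module _ {n} (ρ : Vec (Fin (suc k)) n) where

    evalFin : Expr n → Fin (suc k)
    evalFin (var i) = lookup ρ i
    evalFin (lit c) = c mod suc k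
    evalFin (e ⊞ f) = addF (evalFin e) (evalFin f)
    evalFin (⊟ e)   = negF (evalFin e)

    evalℤ : Expr n → ℤ
    evalℤ (var i) = ⟦ lookup ρ i ⟧
    evalℤ (lit c) = + c
    evalℤ (e ⊞ f) = evalℤ e + evalℤ f
    evalℤ (⊟ e)   = - evalℤ e

    evalFin-correct : ∀ e → ⟦ evalFin e ⟧ ≡ evalℤ e modulo suc k
    evalFin-correct (var i) = ≡-mod-refl
    evalFin-correct (lit c) = ⟦mod⟧ c
    evalFin-correct (e ⊞ f) =
      ≡-mod-trans (⟦addF⟧ (evalFin e) (evalFin f)) (+-cong-mod (evalFin-correct e) (evalFin-correct f))
    evalFin-correct (⊟ e)   = ≡-mod-trans (⟦negF⟧ (evalFin e)) (neg-cong-mod (evalFin-correct e))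

    solve : ∀ e f → evalℤ e ≡ evalℤ f modulo suc k → evalFin e ≡ evalFin f
    solve e f e≡f =
      ⟦⟧-injective (≡-mod-trans (evalFin-correct e) (≡-mod-trans e≡f (≡-mod-sym (evalFin-correct f))))

  +-assoc : ∀ a b c → addF (addF a b) c ≡ addF a (addF b c)
  +-assoc a b c = solve (a ∷ b ∷ c ∷ []) (var 0F ⊞ var 1F ⊞ var 2F) (var 0F ⊞ (var 1F ⊞ var 2F))
    (≡⇒≡-mod (ring ⟦ a ⟧ ⟦ b ⟧ ⟦ c ⟧))
    where ring : ∀ x y z → x + y + z ≡ x + (y + z)
          ring = solve-∀

  a-b-c≡a-[b+c] : ∀ a b c → addF (addF a (negF b)) (negF c) ≡ addF a (negF (addF b c))
  a-b-c≡a-[b+c] a b c =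
    solve (a ∷ b ∷ c ∷ []) (var 0F ⊞ ⊟ var 1F ⊞ ⊟ var 2F) (var 0F ⊞ ⊟ (var 1F ⊞ var 2F))
    (≡⇒≡-mod (ring ⟦ a ⟧ ⟦ b ⟧ ⟦ c ⟧))
    where ring : ∀ x y z → x + - y + - z ≡ x + - (y + z)
          ring = solve-∀

  a-b+c≡a-[b-c] : ∀ a b c → addF (addF a (negF b)) c ≡ addF a (negF (addF b (negF c)))
  a-b+c≡a-[b-c] a b c =
    solve (a ∷ b ∷ c ∷ []) (var 0F ⊞ ⊟ var 1F ⊞ var 2F) (var 0F ⊞ ⊟ (var 1F ⊞ ⊟ var 2F))
    (≡⇒≡-mod (ring ⟦ a ⟧ ⟦ b ⟧ ⟦ c ⟧))
    where ring : ∀ x y z → x + - y + z ≡ x + - (y + - z)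
          ring = solve-∀

  +-identityˡ : ∀ a → addF Fin.zero a ≡ a
  +-identityˡ a = solve (Fin.zero ∷ a ∷ []) (var 0F ⊞ var 1F) (var 1F) (≡⇒≡-mod (ring ⟦ a ⟧))
    where ring : ∀ x → + 0 + x ≡ x
          ring = solve-∀

  +-identityʳ : ∀ a → addF a Fin.zero ≡ a
  +-identityʳ a = solve (Fin.zero ∷ a ∷ []) (var 1F ⊞ var 0F) (var 1F) (≡⇒≡-mod (ring ⟦ a ⟧))
    where ring : ∀ x → x + + 0 ≡ x
          ring = solve-∀

  a-0≡a : ∀ a → addF a (negF Fin.zero) ≡ a
  a-0≡a a = solve (Fin.zero ∷ a ∷ []) (var 1F ⊞ ⊟ var 0F) (var 1F) (≡⇒≡-mod (ring ⟦ a ⟧))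
    where ring : ∀ x → x + - + 0 ≡ x
          ring = solve-∀

  +-inverseˡ : ∀ a → addF (negF a) a ≡ Fin.zero
  +-inverseˡ a = solve (Fin.zero ∷ a ∷ []) (⊟ var 1F ⊞ var 1F) (var 0F) (≡⇒≡-mod (ring ⟦ a ⟧))
    where ring : ∀ x → - x + x ≡ + 0
          ring = solve-∀

  +-inverseʳ : ∀ a → addF a (negF a) ≡ Fin.zero
  +-inverseʳ a = solve (Fin.zero ∷ a ∷ []) (var 1F ⊞ ⊟ var 1F) (var 0F) (≡⇒≡-mod (ring ⟦ a ⟧))
    where ring : ∀ x → x + - x ≡ + 0
          ring = solve-∀

  -‿involutive : ∀ a → negF (negF a) ≡ a
  -‿involutive a = solve (a ∷ []) (⊟ ⊟ var 0F) (var 0F) (≡⇒≡-mod (ℤ.neg-involutive ⟦ a ⟧))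

  -‿injective : ∀ {a b} → negF a ≡ negF b → a ≡ b
  -‿injective {a} {b} eq = trans (sym (-‿involutive a)) (trans (cong negF eq) (-‿involutive b))

  +-cancelˡ : ∀ c {a b} → addF c a ≡ addF c b → a ≡ b
  +-cancelˡ c {a} {b} eq = trans (sym (undo a)) (trans (cong (addF (negF c)) eq) (undo b))
    where undo : ∀ a → addF (negF c) (addF c a) ≡ a
          undo a = solve (c ∷ a ∷ []) (⊟ var 0F ⊞ (var 0F ⊞ var 1F)) (var 1F) (≡⇒≡-mod (ring ⟦ c ⟧ ⟦ a ⟧))
            where ring : ∀ c a → - c + (c + a) ≡ a
                  ring = solve-∀

  +-cancelʳ : ∀ c {a b} → addF a c ≡ addF b c → a ≡ b
  +-cancelʳ c {a} {b} eq = trans (sym (undo a)) (trans (cong (λ x → addF x (negF c)) eq) (undo b))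
    where undo : ∀ a → addF (addF a c) (negF c) ≡ a
          undo a = solve (c ∷ a ∷ []) (var 1F ⊞ var 0F ⊞ ⊟ var 0F) (var 1F) (≡⇒≡-mod (ring ⟦ c ⟧ ⟦ a ⟧))
            where ring : ∀ c a → a + c + - c ≡ a
                  ring = solve-∀

  infixr 7 _·_
  _·_ : ℕ → Fin (suc k) → Fin (suc k)
  c · a = (c ℕ.* toℕ a) mod suc k

  ⟦·⟧ : ∀ c a → ⟦ c · a ⟧ ≡ + c * ⟦ a ⟧ modulo suc k
  ⟦·⟧ c a = ≡-mod-trans (⟦mod⟧ (c ℕ.* toℕ a)) (≡⇒≡-mod (ℤ.pos-* c (toℕ a)))

  ·-suc : ∀ c a → suc c · a ≡ addF (c · a) a
  ·-suc c a = ⟦⟧-injective (begin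
    ⟦ suc c · a ⟧           ≈⟨ ⟦·⟧ (suc c) a ⟩
    + suc c * ⟦ a ⟧         ≡⟨ cong (_* ⟦ a ⟧) (ℤ.pos-+ 1 c) ⟩
    (+ 1 + + c) * ⟦ a ⟧     ≡⟨ ring (+ c) ⟦ a ⟧ ⟩
    + c * ⟦ a ⟧ + ⟦ a ⟧     ≈⟨ +-cong-mod (≡-mod-sym (⟦·⟧ c a)) ≡-mod-refl ⟩
    ⟦ c · a ⟧ + ⟦ a ⟧       ≈⟨ ≡-mod-sym (⟦addF⟧ (c · a) a) ⟩
    ⟦ addF (c · a) a ⟧      ∎)
    where open ≡-mod-Reasoning (suc k)
          ring : ∀ c a → (+ 1 + c) * a ≡ c * a + a
          ring = solve-∀

  ·-zeroʳ : ∀ c → c · Fin.zero ≡ Fin.zero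
  ·-zeroʳ c = cong (_mod suc k) (ℕ.*-zeroʳ c)

  ·≡0⇒≡0-mod : ∀ c a → c · a ≡ Fin.zero → + c * ⟦ a ⟧ ≡ + 0 modulo suc k
  ·≡0⇒≡0-mod c a c·a≡0 = ≡-mod-trans (≡-mod-sym (⟦·⟧ c a)) (≡⇒≡-mod (cong ⟦_⟧ c·a≡0))

  ≡0-mod⇒·≡0 : ∀ c a → + c * ⟦ a ⟧ ≡ + 0 modulo suc k → c · a ≡ Fin.zero
  ≡0-mod⇒·≡0 c a ca≡0 = ⟦⟧-injective (≡-mod-trans (⟦·⟧ c a) ca≡0)

Fin-injective⇒surjective : ∀ {N} (f : Fin N → Fin N) → Injective _≡_ _≡_ f → ∀ y → ∃ λ x → f x ≡ y
Fin-injective⇒surjective {suc N} f f-inj y with Fin.any? (λ x → f x Fin.≟ y)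
... | yes fx≡y = fx≡y
... | no  ∄x   = contradiction (Fin.injective⇒≤ punch-injective) (ℕ.<-irrefl refl)
  where
  y≢f : ∀ x → y ≢ f x
  y≢f x y≡fx = ∄x (x , sym y≡fx)
  punch-injective : Injective _≡_ _≡_ (λ x → punchOut (y≢f x))
  punch-injective = f-inj ∘ Fin.punchOut-injective (y≢f _) (y≢f _)

cast-↔ : ∀ {m n} → m ≡ n → Fin m ↔ Fin n
cast-↔ eq = mk↔ₛ′ (cast eq) (cast (sym eq))
                  (Fin.cast-involutive eq (sym eq)) (Fin.cast-involutive (sym eq) eq)

module _ {A : Set} {N : ℕ} (enumeration : Fin N ↔ A) where
  open Inverse enumeration using (to; from; strictlyInverseˡ; strictlyInverseʳ)

  injective⇒bijective∘enumeration : (f : A → A) → Injective _≡_ _≡_ f → Bijective (f ∘ to)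
  injective⇒bijective∘enumeration f f-inj = (λ _ _ → to-injective ∘ f-inj) , surjective
    where
    to-injective : Injective _≡_ _≡_ to
    to-injective {i} {j} eq = trans (sym (strictlyInverseʳ i)) (trans (cong from eq) (strictlyInverseʳ j))
    from-injective : Injective _≡_ _≡_ from
    from-injective {x} {y} eq = trans (sym (strictlyInverseˡ x)) (trans (cong to eq) (strictlyInverseˡ y))
    surjective : ∀ z → ∃ λ i → f (to i) ≡ z
    surjective z
      with Fin-injective⇒surjective (from ∘ f ∘ to) (to-injective ∘ f-inj ∘ from-injective) (from z)
    ... | i , eq = i , trans (sym (strictlyInverseˡ _)) (trans (cong to eq) (strictlyInverseˡ z))

tabulate-const : ∀ {A : Set} n (f : Fin n → A) {b} → (∀ i → f i ≡ b) → tabulate f ≡ replicate n b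
tabulate-const zero    f _   = refl
tabulate-const (suc n) f f≡b = cong₂ _∷_ (f≡b Fin.zero) (tabulate-const n (f ∘ Fin.suc) (f≡b ∘ Fin.suc))

tabulate-↭-almostConstant : ∀ {A : Set} {n} (f : Fin n → A) i₀ {a b} →
                            f i₀ ≡ a → (∀ i → i ≢ i₀ → f i ≡ b) →
                            tabulate f ↭ replicate (n ℕ.∸ 1) b ++ [ a ]
tabulate-↭-almostConstant {n = suc n} f Fin.zero {a} {b} fi₀≡a f≡b = ↭-trans
  (↭-reflexive (cong₂ _∷_ fi₀≡a (tabulate-const n (f ∘ Fin.suc) (λ i → f≡b (Fin.suc i) λ ()))))
  (∷↭∷ʳ a (replicate n b))
tabulate-↭-almostConstant {n = suc (suc n)} f (Fin.suc i₀) {a} {b} fi₀≡a f≡b = ↭-trans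
  (↭-reflexive (cong (_∷ _) (f≡b Fin.zero λ ())))
  (prep b (tabulate-↭-almostConstant (f ∘ Fin.suc) i₀ fi₀≡a
                                     (λ i i≢i₀ → f≡b (Fin.suc i) (i≢i₀ ∘ Fin.suc-injective))))

module Swap {A : Set} (_≟_ : DecidableEquality A) where

  swap : A → A → A → A
  swap a b x with x ≟ a
  ... | yes _ = b
  ... | no  _ with x ≟ b
  ...   | yes _ = a
  ...   | no  _ = x

  swap-matchˡ : ∀ a b → swap a b a ≡ b
  swap-matchˡ a b with a ≟ a
  ... | yes _   = refl
  ... | no  a≢a = contradiction refl a≢a

  swap-matchʳ : ∀ a b → swap a b b ≡ a
  swap-matchʳ a b with b ≟ a
  ... | yes b≡a = b≡a
  ... | no  _ with b ≟ b
  ...   | yes _   = refl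
  ...   | no  b≢b = contradiction refl b≢b

  swap-other : ∀ {a b x} → x ≢ a → x ≢ b → swap a b x ≡ x
  swap-other {a} {b} {x} x≢a x≢b with x ≟ a
  ... | yes x≡a = contradiction x≡a x≢a
  ... | no  _ with x ≟ b
  ...   | yes x≡b = contradiction x≡b x≢b
  ...   | no  _   = refl

  swap-involutive : ∀ a b x → swap a b (swap a b x) ≡ x
  swap-involutive a b x with x ≟ a
  ... | yes x≡a = trans (swap-matchʳ a b) (sym x≡a)
  ... | no  x≢a with x ≟ b
  ...   | yes x≡b = trans (swap-matchˡ a b) (sym x≡b)
  ...   | no  x≢b = swap-other x≢a x≢b

  swap-injective : ∀ a b → Injective _≡_ _≡_ (swap a b)
  swap-injective a b {x} {x′} eq =
    trans (sym (swap-involutive a b x)) (trans (cong (swap a b) eq) (swap-involutive a b x′))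

  rotate : A → A → A → A → A
  rotate q₀ q₁ q₂ = swap q₀ q₁ ∘ swap q₁ q₂

  rotate-injective : ∀ q₀ q₁ q₂ → Injective _≡_ _≡_ (rotate q₀ q₁ q₂)
  rotate-injective q₀ q₁ q₂ = swap-injective q₁ q₂ ∘ swap-injective q₀ q₁

  module _ {q₀ q₁ q₂ : A} (q₀≢q₁ : q₀ ≢ q₁) (q₀≢q₂ : q₀ ≢ q₂) (q₁≢q₂ : q₁ ≢ q₂) where

    rotate-q₀ : rotate q₀ q₁ q₂ q₀ ≡ q₁
    rotate-q₀ = trans (cong (swap q₀ q₁) (swap-other q₀≢q₁ q₀≢q₂)) (swap-matchˡ q₀ q₁)

    rotate-q₁ : rotate q₀ q₁ q₂ q₁ ≡ q₂
    rotate-q₁ = trans (cong (swap q₀ q₁) (swap-matchˡ q₁ q₂)) (swap-other (q₀≢q₂ ∘ sym) (q₁≢q₂ ∘ sym))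

    rotate-q₂ : rotate q₀ q₁ q₂ q₂ ≡ q₀
    rotate-q₂ = trans (cong (swap q₀ q₁) (swap-matchʳ q₁ q₂)) (swap-matchʳ q₀ q₁)

    rotate-other : ∀ {x} → x ≢ q₀ → x ≢ q₁ → x ≢ q₂ → rotate q₀ q₁ q₂ x ≡ x
    rotate-other x≢q₀ x≢q₁ x≢q₂ = trans (cong (swap q₀ q₁) (swap-other x≢q₁ x≢q₂)) (swap-other x≢q₀ x≢q₁)

module GeneralisedDihedral (m n : ℕ) where

  open import Data.Integer.Base using (_+_; _*_; -_; _-_)

  module A = FinMod m
  -- suc (n + 3 * suc n) is 4 * suc n by definition.
  module B = FinMod (n ℕ.+ 3 ℕ.* suc n)
  module T = FinMod 1

  Γ : Set
  Γ = GD (suc m) (suc n)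

  ⟨⟩-cong : ∀ {a a′ b b′ t t′} → a ≡ a′ → b ≡ b′ → t ≡ t′ →
            _≡_ {A = Γ} ⟨ (a , b) , t ⟩ ⟨ (a′ , b′) , t′ ⟩
  ⟨⟩-cong refl refl refl = refl

  proj-a : Γ → Fin (suc m)
  proj-a ⟨ (a , _) , _ ⟩ = a

  proj-b : Γ → Fin (4 ℕ.* suc n)
  proj-b ⟨ (_ , b) , _ ⟩ = b

  proj-t : Γ → Fin 2
  proj-t ⟨ _ , t ⟩ = t

  _≟_ : DecidableEquality Γ
  ⟨ x ⟩ ≟ ⟨ y ⟩ =
    map′ (cong ⟨_⟩) (cong GD.elt) (Product.≡-dec (Product.≡-dec Fin._≟_ Fin._≟_) Fin._≟_ x y)

  ⊖_ : Γ → Γ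
  ⊖ ⟨ (a , b) , 0F ⟩ = ⟨ (negF a , negF b) , 0F ⟩
  ⊖ ⟨ (a , b) , 1F ⟩ = ⟨ (a , b) , 1F ⟩

  ⊕-assoc : ∀ x y z → (x ⊕ y) ⊕ z ≡ x ⊕ (y ⊕ z)
  ⊕-assoc ⟨ (a , b) , t@0F ⟩ ⟨ (a′ , b′) , t′@0F ⟩ ⟨ (a″ , b″) , t″ ⟩ =
    ⟨⟩-cong (A.+-assoc a a′ a″) (B.+-assoc b b′ b″) (T.+-assoc t t′ t″)
  ⊕-assoc ⟨ (a , b) , t@0F ⟩ ⟨ (a′ , b′) , t′@1F ⟩ ⟨ (a″ , b″) , t″ ⟩ =
    ⟨⟩-cong (A.+-assoc a a′ (negF a″)) (B.+-assoc b b′ (negF b″)) (T.+-assoc t t′ t″)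
  ⊕-assoc ⟨ (a , b) , t@1F ⟩ ⟨ (a′ , b′) , t′@0F ⟩ ⟨ (a″ , b″) , t″ ⟩ =
    ⟨⟩-cong (A.a-b-c≡a-[b+c] a a′ a″) (B.a-b-c≡a-[b+c] b b′ b″) (T.+-assoc t t′ t″)
  ⊕-assoc ⟨ (a , b) , t@1F ⟩ ⟨ (a′ , b′) , t′@1F ⟩ ⟨ (a″ , b″) , t″ ⟩ =
    ⟨⟩-cong (A.a-b+c≡a-[b-c] a a′ a″) (B.a-b+c≡a-[b-c] b b′ b″) (T.+-assoc t t′ t″)

  ⊕-identityˡ : ∀ x → identity ⊕ x ≡ x
  ⊕-identityˡ ⟨ (a , b) , t ⟩ = ⟨⟩-cong (A.+-identityˡ a) (B.+-identityˡ b) (T.+-identityˡ t)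

  ⊕-identityʳ : ∀ x → x ⊕ identity ≡ x
  ⊕-identityʳ ⟨ (a , b) , 0F ⟩ = ⟨⟩-cong (A.+-identityʳ a) (B.+-identityʳ b) refl
  ⊕-identityʳ ⟨ (a , b) , 1F ⟩ = ⟨⟩-cong (A.a-0≡a a) (B.a-0≡a b) refl

  ⊕-inverseˡ : ∀ x → (⊖ x) ⊕ x ≡ identity
  ⊕-inverseˡ ⟨ (a , b) , 0F ⟩ = ⟨⟩-cong (A.+-inverseˡ a) (B.+-inverseˡ b) refl
  ⊕-inverseˡ ⟨ (a , b) , 1F ⟩ = ⟨⟩-cong (A.+-inverseʳ a) (B.+-inverseʳ b) refl

  ⊕-inverseʳ : ∀ x → x ⊕ (⊖ x) ≡ identity
  ⊕-inverseʳ ⟨ (a , b) , 0F ⟩ = ⟨⟩-cong (A.+-inverseʳ a) (B.+-inverseʳ b) refl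
  ⊕-inverseʳ ⟨ (a , b) , 1F ⟩ = ⟨⟩-cong (A.+-inverseʳ a) (B.+-inverseʳ b) refl

  Γ-isGroup : IsGroup _≡_ _⊕_ identity ⊖_
  Γ-isGroup = record
    { isMonoid = record
      { isSemigroup = record
        { isMagma = record { isEquivalence = isEquivalence ; ∙-cong = cong₂ _⊕_ }
        ; assoc = ⊕-assoc
        }
      ; identity = ⊕-identityˡ , ⊕-identityʳ
      }
    ; inverse = ⊕-inverseˡ , ⊕-inverseʳ
    ; ⁻¹-cong = cong ⊖_
    }

  Γ-group : Group 0ℓ 0ℓ
  Γ-group = record { isGroup = Γ-isGroup }

  open import Algebra.Properties.Group Γ-group using (∙-cancelʳ; ⁻¹-injective; \\-leftDividesˡ)

  module Telescope (y : Γ → Γ) (e : Γ) where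

    y⁺ : Γ → Γ
    y⁺ q = q ⊕ y q

    tail : ∀ k → Γ → Fin (suc k) → Γ
    tail zero    q 0F           = (⊖ q) ⊕ e
    tail (suc k) q 0F           = y q
    tail (suc k) q (Fin.suc j) = tail k (y⁺ q) j

    rowSumFrom-tail : ∀ k d q → rowSumFrom (suc k) (d ⊕ q) (tail k q) ≡ d ⊕ e
    rowSumFrom-tail zero    d q = trans (⊕-assoc d q _) (cong (d ⊕_) (\\-leftDividesˡ q e))
    rowSumFrom-tail (suc k) d q =
      trans (cong (λ s → rowSumFrom (suc k) s (tail k (y⁺ q))) (⊕-assoc d q (y q))) (rowSumFrom-tail k d (y⁺ q))

    tail-injective : Injective _≡_ _≡_ y → Injective _≡_ _≡_ y⁺ →
                     ∀ k j → Injective _≡_ _≡_ (λ q → tail k q j)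
    tail-injective _     _      zero    0F          = ⁻¹-injective ∘ ∙-cancelʳ e _ _
    tail-injective y-inj _      (suc k) 0F          = y-inj
    tail-injective y-inj y⁺-inj (suc k) (Fin.suc j) = y⁺-inj ∘ tail-injective y-inj y⁺-inj k j

  module Rows (y σ σ⁻ : Γ → Γ) (e : Γ) where
    open Telescope y e

    row : ∀ k → Γ → Fin (3 ℕ.+ k) → Γ
    row k x 0F                    = x
    row k x 1F                    = y (σ⁻ x)
    row k x (Fin.suc (Fin.suc j)) = tail k (y⁺ (σ x)) j

    rowSum-row : ∀ k d x → x ⊕ y (σ⁻ x) ≡ d ⊕ y⁺ (σ x) → rowSum (3 ℕ.+ k) (row k x) ≡ d ⊕ e
    rowSum-row k d x eq = trans (cong (λ s → rowSumFrom (suc k) s (tail k (y⁺ (σ x)))) eq)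
                                (rowSumFrom-tail k d (y⁺ (σ x)))

    row-injective : Injective _≡_ _≡_ y → Injective _≡_ _≡_ y⁺ →
                    Injective _≡_ _≡_ σ → Injective _≡_ _≡_ σ⁻ →
                    ∀ k j → Injective _≡_ _≡_ (λ x → row k x j)
    row-injective _     _      _     _      k 0F                    = λ eq → eq
    row-injective y-inj _      _     σ⁻-inj k 1F                    = σ⁻-inj ∘ y-inj
    row-injective y-inj y⁺-inj σ-inj _      k (Fin.suc (Fin.suc j)) =
      σ-inj ∘ y⁺-inj ∘ tail-injective y-inj y⁺-inj k j

  -- cast, unlike subst, never evaluates the (solver-generated) proof of the size equation.
  Γ-enumeration : Fin (8 ℕ.* suc m ℕ.* suc n) ↔ Γ
  Γ-enumeration =
    (mk↔ₛ′ ⟨_⟩ GD.elt (λ _ → refl) (λ _ → refl) ↔-∘ ((Fin.*↔× ×-↔ ↔-id (Fin 2)) ↔-∘ Fin.*↔×))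
    ↔-∘ cast-↔ (sym (size m n))
    where size : ∀ m n → suc m ℕ.* (4 ℕ.* suc n) ℕ.* 2 ≡ 8 ℕ.* suc m ℕ.* suc n
          size = ℕ-Ring.solve-∀

  translation : Fin (suc m) → Fin (4 ℕ.* suc n) → Γ
  translation a b = ⟨ (a , b) , 0F ⟩

  mult-translation : ∀ c a b → mult c (translation a b) ≡ translation (c A.· a) (c B.· b)
  mult-translation zero    a b = refl
  mult-translation (suc c) a b = trans (cong (_⊕ translation a b) (mult-translation c a b))
                                       (⟨⟩-cong (sym (A.·-suc c a)) (sym (B.·-suc c b)) refl)

  hasOrder-translation-2 : HasOrder (translation Fin.zero (2 mod (4 ℕ.* suc n))) (2 ℕ.* suc n)
  hasOrder-translation-2 = ℕ.s≤s ℕ.z≤n , mult-2N≡identity , mult-c≢identity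
    where
    4N : ℕ
    4N = 4 ℕ.* suc n
    2N·2≡0 : + (2 ℕ.* suc n) * B.⟦ 2 mod 4N ⟧ ≡ + 0 modulo 4N
    2N·2≡0 = ≡-mod-trans (*-congˡ-mod (+ (2 ℕ.* suc n)) (B.⟦mod⟧ 2)) (mk≡mod (+ 1) (begin
      + (2 ℕ.* suc n) * + 2  ≡⟨ ℤ.pos-* (2 ℕ.* suc n) 2 ⟨
      + (2 ℕ.* suc n ℕ.* 2)  ≡⟨ cong +_ (ℕ-ring n) ⟩
      + 4N                   ≡⟨ ring (+ 4N) ⟩
      + 0 + + 1 * + 4N       ∎))
      where
      open ≡-Reasoning
      ℕ-ring : ∀ n → 2 ℕ.* suc n ℕ.* 2 ≡ 4 ℕ.* suc n
      ℕ-ring = ℕ-Ring.solve-∀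
      ring : ∀ K → K ≡ + 0 + + 1 * K
      ring = solve-∀
    mult-2N≡identity : mult (2 ℕ.* suc n) (translation Fin.zero (2 mod 4N)) ≡ identity
    mult-2N≡identity = trans (mult-translation (2 ℕ.* suc n) Fin.zero (2 mod 4N))
      (⟨⟩-cong (A.·-zeroʳ (2 ℕ.* suc n)) (B.≡0-mod⇒·≡0 (2 ℕ.* suc n) (2 mod 4N) 2N·2≡0) refl)
    mult-c≢identity : ∀ c → 0 ℕ.< c → c ℕ.< 2 ℕ.* suc n →
                      mult c (translation Fin.zero (2 mod 4N)) ≢ identity
    mult-c≢identity c 0<c c<2N mult-c≡identity = ℕ.<-irrefl (sym 2c≡0) (ℕ.*-monoʳ-< 2 0<c)
      where
      c·2≡0 : c B.· (2 mod 4N) ≡ Fin.zero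
      c·2≡0 = cong proj-b (trans (sym (mult-translation c Fin.zero (2 mod 4N))) mult-c≡identity)
      2c<4N : 2 ℕ.* c ℕ.< 4N
      2c<4N = subst (2 ℕ.* c ℕ.<_) (sym (ℕ.*-assoc 2 2 (suc n))) (ℕ.*-monoʳ-< 2 c<2N)
      2c≡0 : 2 ℕ.* c ≡ 0
      2c≡0 = ≡-mod-ℕ-injective 2c<4N (ℕ.s≤s ℕ.z≤n) (begin
        + (2 ℕ.* c)           ≡⟨ trans (ℤ.pos-* 2 c) (ℤ.*-comm (+ 2) (+ c)) ⟩
        + c * + 2             ≈⟨ *-congˡ-mod (+ c) (≡-mod-sym (B.⟦mod⟧ 2)) ⟩
        + c * B.⟦ 2 mod 4N ⟧  ≈⟨ B.·≡0⇒≡0-mod c (2 mod 4N) c·2≡0 ⟩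
        + 0                   ∎)
        where open ≡-mod-Reasoning 4N

module Construction (s u : ℕ) where

  open import Data.Integer.Base using (_+_; _*_; -_; _-_)

  open GeneralisedDihedral (s ℕ.+ s) (u ℕ.+ u)
  module F₄ = FinMod 3

  M N : ℕ
  M = suc (s ℕ.+ s)
  N = suc (u ℕ.+ u)

  -- τ b separates b from b + 2n and from 1 - b, the two collisions that θ⁺ and θ would otherwise have.
  twist : Fin 4 → Fin 2
  twist 0F = 0F
  twist 1F = 1F
  twist 2F = 1F
  twist 3F = 0F

  twist-+2 : ∀ r → twist (addF r 2F) ≢ twist r
  twist-+2 0F ()
  twist-+2 1F ()
  twist-+2 2F ()
  twist-+2 3F ()

  twist-reflect : ∀ r → twist (addF (negF r) 1F) ≢ twist r
  twist-reflect 0F ()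
  twist-reflect 1F ()
  twist-reflect 2F ()
  twist-reflect 3F ()

  residue₄ : Fin (4 ℕ.* N) → Fin 4
  residue₄ b = toℕ b mod 4

  τ : Fin (4 ℕ.* N) → Fin 2
  τ b = twist (residue₄ b)

  4N≡2[2N] : 4 ℕ.* N ≡ 2 ℕ.* (2 ℕ.* N)
  4N≡2[2N] = ℕ.*-assoc 2 2 N

  mod4N⇒mod2 : ∀ {x y} → x ≡ y modulo (4 ℕ.* N) → x ≡ y modulo 2
  mod4N⇒mod2 = ≡-mod-divisor (+ (2 ℕ.* N)) (trans (cong +_ 4N≡2[2N]) (ℤ.pos-* 2 (2 ℕ.* N)))

  mod4N⇒mod4 : ∀ {x y} → x ≡ y modulo (4 ℕ.* N) → x ≡ y modulo 4
  mod4N⇒mod4 = ≡-mod-divisor (+ N) (ℤ.pos-* 4 N)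

  2N≡2-mod4 : + (2 ℕ.* N) ≡ + 2 modulo 4
  2N≡2-mod4 = mk≡mod (+ u) (begin
    + (2 ℕ.* N)        ≡⟨ cong +_ (ring u) ⟩
    + (2 ℕ.+ u ℕ.* 4)  ≡⟨ ℤ.pos-+ 2 (u ℕ.* 4) ⟩
    + 2 + + (u ℕ.* 4)  ≡⟨ cong (_+_ (+ 2)) (ℤ.pos-* u 4) ⟩
    + 2 + + u * + 4    ∎)
    where open ≡-Reasoning
          ring : ∀ u → 2 ℕ.* suc (u ℕ.+ u) ≡ 2 ℕ.+ u ℕ.* 4
          ring = ℕ-Ring.solve-∀

  ⟦residue₄⟧ : ∀ b → F₄.⟦ residue₄ b ⟧ ≡ B.⟦ b ⟧ modulo 4
  ⟦residue₄⟧ b = F₄.⟦mod⟧ (toℕ b)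

  τ-+2 : ∀ {b b′} → B.⟦ b ⟧ ≡ B.⟦ b′ ⟧ + + 2 modulo 4 → τ b ≢ τ b′
  τ-+2 {b} {b′} b≡b′+2 = twist-+2 (residue₄ b′) ∘ trans (cong twist (sym residue≡))
    where
    open F₄ using (solve; var; lit; _⊞_)
    residue≡ : residue₄ b ≡ addF (residue₄ b′) 2F
    residue≡ = solve (residue₄ b ∷ residue₄ b′ ∷ []) (var 0F) (var 1F ⊞ lit 2) (begin
      F₄.⟦ residue₄ b ⟧         ≈⟨ ⟦residue₄⟧ b ⟩
      B.⟦ b ⟧                   ≈⟨ b≡b′+2 ⟩
      B.⟦ b′ ⟧ + + 2            ≈⟨ +-cong-mod (≡-mod-sym (⟦residue₄⟧ b′)) (≡-mod-refl {x = + 2}) ⟩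
      F₄.⟦ residue₄ b′ ⟧ + + 2  ∎)
      where open ≡-mod-Reasoning 4

  τ-reflect : ∀ {b b′} → B.⟦ b ⟧ ≡ - B.⟦ b′ ⟧ + + 1 modulo 4 → τ b ≢ τ b′
  τ-reflect {b} {b′} b≡1-b′ = twist-reflect (residue₄ b′) ∘ trans (cong twist (sym residue≡))
    where
    open F₄ using (solve; var; lit; _⊞_; ⊟_)
    residue≡ : residue₄ b ≡ addF (negF (residue₄ b′)) 1F
    residue≡ = solve (residue₄ b ∷ residue₄ b′ ∷ []) (var 0F) (⊟ var 1F ⊞ lit 1) (begin
      F₄.⟦ residue₄ b ⟧            ≈⟨ ⟦residue₄⟧ b ⟩
      B.⟦ b ⟧                      ≈⟨ b≡1-b′ ⟩
      - B.⟦ b′ ⟧ + + 1             ≈⟨ +-cong-mod (neg-cong-mod (≡-mod-sym (⟦residue₄⟧ b′))) ≡-mod-refl ⟩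
      - F₄.⟦ residue₄ b′ ⟧ + + 1   ∎)
      where open ≡-mod-Reasoning 4

  τ-double-injective : ∀ {b b′} → B.⟦ b ⟧ + B.⟦ b ⟧ ≡ B.⟦ b′ ⟧ + B.⟦ b′ ⟧ modulo (4 ℕ.* N) →
                       τ b ≡ τ b′ → b ≡ b′
  τ-double-injective {b} {b′} 2b≡2b′ τb≡τb′ =
    [ equal , ⊥-elim ∘ apart ]′ (≡-mod-parity-split {k = 2 ℕ.* N} b≡b′-mod2N)
    where
    b≡b′-mod2N : B.⟦ b ⟧ ≡ B.⟦ b′ ⟧ modulo (2 ℕ.* N)
    b≡b′-mod2N = halve-mod-double (subst (B.⟦ b ⟧ + B.⟦ b ⟧ ≡ B.⟦ b′ ⟧ + B.⟦ b′ ⟧ modulo_) 4N≡2[2N] 2b≡2b′)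
    equal : B.⟦ b ⟧ ≡ B.⟦ b′ ⟧ modulo (2 ℕ.* (2 ℕ.* N)) → b ≡ b′
    equal = B.⟦⟧-injective ∘ subst (B.⟦ b ⟧ ≡ B.⟦ b′ ⟧ modulo_) (sym 4N≡2[2N])
    apart : B.⟦ b ⟧ ≡ B.⟦ b′ ⟧ + + (2 ℕ.* N) modulo (2 ℕ.* (2 ℕ.* N)) → ⊥
    apart b≡b′+2N = τ-+2 {b} {b′} (begin
      B.⟦ b ⟧                   ≈⟨ mod4N⇒mod4 (subst (B.⟦ b ⟧ ≡ B.⟦ b′ ⟧ + + (2 ℕ.* N) modulo_) (sym 4N≡2[2N]) b≡b′+2N) ⟩
      B.⟦ b′ ⟧ + + (2 ℕ.* N)    ≈⟨ +-cong-mod (≡-mod-refl {x = B.⟦ b′ ⟧}) 2N≡2-mod4 ⟩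
      B.⟦ b′ ⟧ + + 2            ∎) τb≡τb′
      where open ≡-mod-Reasoning 4

  one : Fin (4 ℕ.* N)
  one = 1 mod (4 ℕ.* N)

  θ : Γ → Γ
  θ ⟨ (a , b) , 0F ⟩ = ⟨ (a , b) , τ b ⟩
  θ ⟨ (a , b) , 1F ⟩ = ⟨ (negF a , addF (negF b) one) , τ b ⟩

  θ⁺ : Γ → Γ
  θ⁺ x = x ⊕ θ x

  ⟦1-b⟧ : ∀ b → B.⟦ addF (negF b) one ⟧ ≡ - B.⟦ b ⟧ + + 1 modulo (4 ℕ.* N)
  ⟦1-b⟧ b = B.evalFin-correct (b ∷ []) (B.⊟ B.var 0F B.⊞ B.lit 1)

  ⟦2b-1⟧ : ∀ b → B.⟦ addF b (negF (addF (negF b) one)) ⟧ ≡ B.⟦ b ⟧ + B.⟦ b ⟧ - + 1 modulo (4 ℕ.* N)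
  ⟦2b-1⟧ b = ≡-mod-trans (B.evalFin-correct (b ∷ []) (B.var 0F B.⊞ B.⊟ (B.⊟ B.var 0F B.⊞ B.lit 1)))
                         (≡⇒≡-mod (ring B.⟦ b ⟧))
    where ring : ∀ x → x + - (- x + + 1) ≡ x + x - + 1
          ring = solve-∀

  ⟦proj-b⟧-cong : ∀ {x x′} → x ≡ x′ → B.⟦ proj-b x ⟧ ≡ B.⟦ proj-b x′ ⟧
  ⟦proj-b⟧-cong = cong (B.⟦_⟧ ∘ proj-b)

  θ-injective : Injective _≡_ _≡_ θ
  θ-injective {⟨ (a , b) , 0F ⟩} {⟨ (a′ , b′) , 0F ⟩} eq = ⟨⟩-cong (cong proj-a eq) (cong proj-b eq) refl
  θ-injective {⟨ (a , b) , 1F ⟩} {⟨ (a′ , b′) , 1F ⟩} eq =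
    ⟨⟩-cong (A.-‿injective (cong proj-a eq)) (B.-‿injective (B.+-cancelʳ one (cong proj-b eq))) refl
  θ-injective {⟨ (a , b) , 0F ⟩} {⟨ (a′ , b′) , 1F ⟩} eq = ⊥-elim (τ-reflect {b} {b′}
    (mod4N⇒mod4 (≡-mod-subst (⟦proj-b⟧-cong eq) ≡-mod-refl (⟦1-b⟧ b′))) (cong proj-t eq))
  θ-injective {⟨ (a , b) , 1F ⟩} {⟨ (a′ , b′) , 0F ⟩} eq = ⊥-elim (τ-reflect {b′} {b}
    (mod4N⇒mod4 (≡-mod-subst (⟦proj-b⟧-cong (sym eq)) ≡-mod-refl (⟦1-b⟧ b))) (sym (cong proj-t eq)))

  ⟦θ⁺-a⟧ : ∀ x → A.⟦ proj-a (θ⁺ x) ⟧ ≡ A.⟦ proj-a x ⟧ + A.⟦ proj-a x ⟧ modulo M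
  ⟦θ⁺-a⟧ ⟨ (a , b) , 0F ⟩ = A.⟦addF⟧ a a
  ⟦θ⁺-a⟧ ⟨ (a , b) , 1F ⟩ = ≡-mod-trans (A.evalFin-correct (a ∷ []) (A.var 0F A.⊞ A.⊟ A.⊟ A.var 0F))
                                        (≡⇒≡-mod (cong (_+_ A.⟦ a ⟧) (ℤ.neg-involutive A.⟦ a ⟧)))

  θ⁺-a-injective : ∀ x x′ → θ⁺ x ≡ θ⁺ x′ → proj-a x ≡ proj-a x′
  θ⁺-a-injective x x′ eq =
    A.⟦⟧-injective (halve-mod-odd s (≡-mod-subst (cong (A.⟦_⟧ ∘ proj-a) eq) (⟦θ⁺-a⟧ x) (⟦θ⁺-a⟧ x′)))

  θ⁺-injective : Injective _≡_ _≡_ θ⁺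
  θ⁺-injective {x@(⟨ (a , b) , 0F ⟩)} {x′@(⟨ (a′ , b′) , 0F ⟩)} eq = ⟨⟩-cong (θ⁺-a-injective x x′ eq)
    (τ-double-injective {b} {b′} (≡-mod-subst (⟦proj-b⟧-cong eq) (B.⟦addF⟧ b b) (B.⟦addF⟧ b′ b′))
                                 (T.+-cancelˡ 0F (cong proj-t eq))) refl
  θ⁺-injective {x@(⟨ (a , b) , 1F ⟩)} {x′@(⟨ (a′ , b′) , 1F ⟩)} eq = ⟨⟩-cong (θ⁺-a-injective x x′ eq)
    (τ-double-injective {b} {b′} (+-cancelʳ-mod (- + 1) (≡-mod-subst (⟦proj-b⟧-cong eq) (⟦2b-1⟧ b) (⟦2b-1⟧ b′)))
                                 (T.+-cancelˡ 1F (cong proj-t eq))) refl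
  θ⁺-injective {⟨ (a , b) , 0F ⟩} {⟨ (a′ , b′) , 1F ⟩} eq = ⊥-elim (¬double≡double-1-modulo2 B.⟦ b ⟧ B.⟦ b′ ⟧
    (mod4N⇒mod2 (≡-mod-subst (⟦proj-b⟧-cong eq) (B.⟦addF⟧ b b) (⟦2b-1⟧ b′))))
  θ⁺-injective {⟨ (a , b) , 1F ⟩} {⟨ (a′ , b′) , 0F ⟩} eq = ⊥-elim (¬double≡double-1-modulo2 B.⟦ b′ ⟧ B.⟦ b ⟧
    (mod4N⇒mod2 (≡-mod-subst (⟦proj-b⟧-cong (sym eq)) (B.⟦addF⟧ b′ b′) (⟦2b-1⟧ b))))

  residue₄-one : residue₄ one ≡ 1F
  residue₄-one = F₄.⟦⟧-injective (≡-mod-trans (F₄.⟦mod⟧ (toℕ one)) (mod4N⇒mod4 (B.⟦mod⟧ 1)))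

  τ-one : τ one ≡ 1F
  τ-one = cong twist residue₄-one

  p₀ p₁ p₂ offset ordinarySum exceptionalSum : Γ
  p₀ = ⟨ (negF (1 mod M) , one) , 1F ⟩
  p₁ = ⟨ (3 mod M , Fin.zero) , 1F ⟩
  p₂ = ⟨ (1 mod M , Fin.zero) , 0F ⟩
  offset = ⟨ (negF (8 mod M) , 2 mod (4 ℕ.* N)) , 0F ⟩
  ordinarySum = translation (8 mod M) Fin.zero
  exceptionalSum = translation Fin.zero (2 mod (4 ℕ.* N))

  p₁⊕θp₀ : p₁ ⊕ θ p₀ ≡ θ⁺ p₂
  p₁⊕θp₀ = ⟨⟩-cong
    (A.solve [] (A.lit 3 A.⊞ A.⊟ A.⊟ A.⊟ A.lit 1) (A.lit 1 A.⊞ A.lit 1) ≡-mod-refl)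
    (B.solve (Fin.zero ∷ []) (B.var 0F B.⊞ B.⊟ (B.⊟ B.lit 1 B.⊞ B.lit 1)) (B.var 0F B.⊞ B.var 0F) ≡-mod-refl)
    (cong (addF 1F) τ-one)

  p₂⊕θp₁ : p₂ ⊕ θ p₁ ≡ θ⁺ p₀
  p₂⊕θp₁ = ⟨⟩-cong
    (A.solve [] (A.lit 1 A.⊞ A.⊟ A.lit 3) (A.⊟ A.lit 1 A.⊞ A.⊟ A.⊟ A.⊟ A.lit 1) ≡-mod-refl)
    (B.solve (Fin.zero ∷ []) (B.var 0F B.⊞ (B.⊟ B.var 0F B.⊞ B.lit 1)) (B.lit 1 B.⊞ B.⊟ (B.⊟ B.lit 1 B.⊞ B.lit 1)) ≡-mod-refl)
    (sym (cong (addF 1F) τ-one))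

  p₀⊕θp₂ : p₀ ⊕ θ p₂ ≡ offset ⊕ θ⁺ p₁
  p₀⊕θp₂ = ⟨⟩-cong
    (A.solve [] (A.⊟ A.lit 1 A.⊞ A.⊟ A.lit 1) (A.⊟ A.lit 8 A.⊞ (A.lit 3 A.⊞ A.⊟ A.⊟ A.lit 3)) ≡-mod-refl)
    (B.solve (Fin.zero ∷ []) (B.lit 1 B.⊞ B.⊟ B.var 0F) (B.lit 2 B.⊞ (B.var 0F B.⊞ B.⊟ (B.⊟ B.var 0F B.⊞ B.lit 1))) ≡-mod-refl)
    refl

  offset⊕ordinarySum : offset ⊕ ordinarySum ≡ exceptionalSum
  offset⊕ordinarySum = ⟨⟩-cong
    (A.solve (Fin.zero ∷ []) (A.⊟ A.lit 8 A.⊞ A.lit 8) (A.var 0F) ≡-mod-refl)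
    (B.+-identityʳ (2 mod (4 ℕ.* N)))
    refl

  open Swap _≟_ using (rotate; rotate-injective; rotate-q₀; rotate-q₁; rotate-q₂; rotate-other)

  σ σ⁻ : Γ → Γ
  σ  = rotate p₀ p₁ p₂
  σ⁻ = rotate p₀ p₂ p₁

  p₀≢p₁ : p₀ ≢ p₁
  p₀≢p₁ p₀≡p₁ = contradiction (trans (sym residue₄-one) (cong (residue₄ ∘ proj-b) p₀≡p₁)) λ ()

  p₀≢p₂ : p₀ ≢ p₂
  p₀≢p₂ ()

  p₁≢p₂ : p₁ ≢ p₂
  p₁≢p₂ ()

  σ-p₀ : σ p₀ ≡ p₁
  σ-p₀ = rotate-q₀ p₀≢p₁ p₀≢p₂ p₁≢p₂

  σ-p₁ : σ p₁ ≡ p₂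
  σ-p₁ = rotate-q₁ p₀≢p₁ p₀≢p₂ p₁≢p₂

  σ-p₂ : σ p₂ ≡ p₀
  σ-p₂ = rotate-q₂ p₀≢p₁ p₀≢p₂ p₁≢p₂

  σ⁻-p₀ : σ⁻ p₀ ≡ p₂
  σ⁻-p₀ = rotate-q₀ p₀≢p₂ p₀≢p₁ (p₁≢p₂ ∘ sym)

  σ⁻-p₂ : σ⁻ p₂ ≡ p₁
  σ⁻-p₂ = rotate-q₁ p₀≢p₂ p₀≢p₁ (p₁≢p₂ ∘ sym)

  σ⁻-p₁ : σ⁻ p₁ ≡ p₀
  σ⁻-p₁ = rotate-q₂ p₀≢p₂ p₀≢p₁ (p₁≢p₂ ∘ sym)

  exceptional-row : p₀ ⊕ θ (σ⁻ p₀) ≡ offset ⊕ θ⁺ (σ p₀)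
  exceptional-row = begin
    p₀ ⊕ θ (σ⁻ p₀)   ≡⟨ cong (λ z → p₀ ⊕ θ z) σ⁻-p₀ ⟩
    p₀ ⊕ θ p₂        ≡⟨ p₀⊕θp₂ ⟩
    offset ⊕ θ⁺ p₁   ≡⟨ cong (λ z → offset ⊕ θ⁺ z) σ-p₀ ⟨
    offset ⊕ θ⁺ (σ p₀) ∎
    where open ≡-Reasoning

  ordinary-row : ∀ x → x ≢ p₀ → x ⊕ θ (σ⁻ x) ≡ identity ⊕ θ⁺ (σ x)
  ordinary-row x x≢p₀ =
    trans (by-cases x x≢p₀ (x ≟ p₁) (x ≟ p₂)) (sym (⊕-identityˡ (θ⁺ (σ x))))
    where
    open ≡-Reasoning
    by-cases : ∀ x → x ≢ p₀ → Dec (x ≡ p₁) → Dec (x ≡ p₂) → x ⊕ θ (σ⁻ x) ≡ θ⁺ (σ x)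
    by-cases _ _ (yes refl) _ = begin
      p₁ ⊕ θ (σ⁻ p₁)  ≡⟨ cong (λ z → p₁ ⊕ θ z) σ⁻-p₁ ⟩
      p₁ ⊕ θ p₀       ≡⟨ p₁⊕θp₀ ⟩
      θ⁺ p₂           ≡⟨ cong θ⁺ σ-p₁ ⟨
      θ⁺ (σ p₁)       ∎
    by-cases _ _ (no _) (yes refl) = begin
      p₂ ⊕ θ (σ⁻ p₂)  ≡⟨ cong (λ z → p₂ ⊕ θ z) σ⁻-p₂ ⟩
      p₂ ⊕ θ p₁       ≡⟨ p₂⊕θp₁ ⟩
      θ⁺ p₀           ≡⟨ cong θ⁺ σ-p₂ ⟨
      θ⁺ (σ p₂)       ∎
    by-cases x x≢p₀ (no x≢p₁) (no x≢p₂) = begin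
      x ⊕ θ (σ⁻ x)    ≡⟨ cong (λ z → x ⊕ θ z) (rotate-other p₀≢p₂ p₀≢p₁ (p₁≢p₂ ∘ sym) x≢p₀ x≢p₂ x≢p₁) ⟩
      θ⁺ x            ≡⟨ cong θ⁺ (rotate-other p₀≢p₁ p₀≢p₂ p₁≢p₂ x≢p₀ x≢p₁ x≢p₂) ⟨
      θ⁺ (σ x)        ∎

  hasOrder-ordinarySum : HasOrder ordinarySum M
  hasOrder-ordinarySum = ℕ.s≤s ℕ.z≤n , mult-M≡identity , mult-c≢identity
    where
    M·8≡0 : + M * A.⟦ 8 mod M ⟧ ≡ + 0 modulo M
    M·8≡0 = ≡-mod-trans (*-congˡ-mod (+ M) (A.⟦mod⟧ 8)) (mk≡mod (+ 8) (ring (+ M)))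
      where ring : ∀ K → K * + 8 ≡ + 0 + + 8 * K
            ring = solve-∀
    mult-M≡identity : mult M ordinarySum ≡ identity
    mult-M≡identity = trans (mult-translation M (8 mod M) Fin.zero)
      (⟨⟩-cong (A.≡0-mod⇒·≡0 M (8 mod M) M·8≡0) (B.·-zeroʳ M) refl)
    mult-c≢identity : ∀ c → 0 ℕ.< c → c ℕ.< M → mult c ordinarySum ≢ identity
    mult-c≢identity c 0<c c<M mult-c≡identity = ℕ.<-irrefl (sym c≡0) 0<c
      where
      c·8≡0 : c A.· (8 mod M) ≡ Fin.zero
      c·8≡0 = cong proj-a (trans (sym (mult-translation c (8 mod M) Fin.zero)) mult-c≡identity)
      c≡0 : c ≡ 0
      c≡0 = ≡-mod-ℕ-injective c<M (ℕ.s≤s ℕ.z≤n) (*8-cancel-mod-odd s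
        (≡-mod-trans (*-congˡ-mod (+ c) (≡-mod-sym (A.⟦mod⟧ 8))) (A.·≡0⇒≡0-mod c (8 mod M) c·8≡0)))

  open Rows θ σ σ⁻ ordinarySum using (row; rowSum-row; row-injective)

  rowOrder : ∀ {x} → Dec (x ≡ p₀) → ℕ
  rowOrder (yes _) = 2 ℕ.* N
  rowOrder (no  _) = M

  hasOrder-rowSum : ∀ k x (x≟p₀ : Dec (x ≡ p₀)) →
                    HasOrder (rowSum (3 ℕ.+ k) (row k x)) (rowOrder x≟p₀)
  hasOrder-rowSum k x (yes refl) = subst (λ z → HasOrder z (2 ℕ.* N))
    (sym (trans (rowSum-row k offset p₀ exceptional-row) offset⊕ordinarySum))
    hasOrder-translation-2
  hasOrder-rowSum k x (no x≢p₀) = subst (λ z → HasOrder z M)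
    (sym (trans (rowSum-row k identity x (ordinary-row x x≢p₀)) (⊕-identityˡ ordinarySum)))
    hasOrder-ordinarySum

  rowOrder-p₀ : ∀ {x} → x ≡ p₀ → (x≟p₀ : Dec (x ≡ p₀)) → rowOrder x≟p₀ ≡ 2 ℕ.* N
  rowOrder-p₀ _    (yes _)   = refl
  rowOrder-p₀ x≡p₀ (no x≢p₀) = contradiction x≡p₀ x≢p₀

  rowOrder-other : ∀ {x} → x ≢ p₀ → (x≟p₀ : Dec (x ≡ p₀)) → rowOrder x≟p₀ ≡ M
  rowOrder-other x≢p₀ (yes x≡p₀) = contradiction x≡p₀ x≢p₀
  rowOrder-other _    (no _)     = refl

  rowOrders : List ℕ
  rowOrders = replicate (8 ℕ.* M ℕ.* N ℕ.∸ 1) M ++ [ 2 ℕ.* N ]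

  rowSumMatrix : ∀ k → RSM-Γ-orders M N (3 ℕ.+ k) rowOrders
  rowSumMatrix k =
    (λ i → row k (to i)) , columns-bijective , orders , (λ i → hasOrder-rowSum k (to i) (to i ≟ p₀)) , orders-↭
    where
    open Inverse Γ-enumeration using (to; from; strictlyInverseˡ; strictlyInverseʳ)
    columns-bijective : ∀ j → Bijective (λ i → row k (to i) j)
    columns-bijective j = injective⇒bijective∘enumeration Γ-enumeration (λ x → row k x j)
      (row-injective θ-injective θ⁺-injective (rotate-injective p₀ p₁ p₂) (rotate-injective p₀ p₂ p₁) k j)
    orders : Fin (8 ℕ.* M ℕ.* N) → ℕ
    orders i = rowOrder (to i ≟ p₀)
    to≢p₀ : ∀ i → i ≢ from p₀ → to i ≢ p₀
    to≢p₀ i i≢from-p₀ toi≡p₀ = i≢from-p₀ (trans (sym (strictlyInverseʳ i)) (cong from toi≡p₀))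
    orders-↭ : map orders (allFin _) ↭ rowOrders
    orders-↭ = subst (_↭ rowOrders) (sym (List.map-tabulate (λ i → i) orders))
      (tabulate-↭-almostConstant orders (from p₀) (rowOrder-p₀ (strictlyInverseˡ p₀) (to (from p₀) ≟ p₀))
                                 (λ i i≢from-p₀ → rowOrder-other (to≢p₀ i i≢from-p₀) (to i ≟ p₀)))

odd⇒double : ∀ m → ¬ (2 ∣ suc m) → ∃ λ s → m ≡ s ℕ.+ s
odd⇒double zero          _   = 0 , refl
odd⇒double (suc zero)    odd = contradiction (divides 1 refl) odd
odd⇒double (suc (suc m)) odd with odd⇒double m (odd ∘ ∣m∣n⇒∣m+n ∣-refl)
... | s , m≡s+s = suc s , cong suc (trans (cong suc m≡s+s) (sym (ℕ.+-suc s s)))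

-- The natural-number operators are opened only here: the modules above use integer ones of the same names.
open import Data.Nat using (_*_; _∸_; _≤_)

theorem3p4 : (g m n : ℕ) → 3 ≤ g → 1 ≤ m → ¬ (2 ∣ m) → 3 ≤ n → ¬ (2 ∣ n) →
    RSM-Γ-orders m n g (replicate (8 * m * n ∸ 1) m ++ [ 2 * n ])
theorem3p4 _ _ _ (ℕ.s≤s (ℕ.s≤s (ℕ.s≤s {n = k} _))) (ℕ.s≤s {n = m} _) m-odd (ℕ.s≤s {n = n} _) n-odd
  with odd⇒double m m-odd | odd⇒double n n-odd
... | s , refl | u , refl = Construction.rowSumMatrix s u k
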